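{- For $k\ge 1$ let $\mathcal{M}_k$ be the set of primitive $k\times k$ Fishburn matrices and let \[ \mathbf{P}_k(v,w,x,y)=\sum_{M\in\mathcal{M}_k} x^{\mathrm{iso}(M)}y^{\min(M)}v^{\max(M)}w^{\mathrm{int}(M)}. \] Then for every $k\ge 1$, \[ \mathbf{P}_{k+1}(v,w,x,y)=v\,\mathbf{P}_k(v+w+vw,\,w,\,x+y+xy,\,y)-v\,\mathbf{P}_k(v,w,x,y). \]
   Context: A Fishburn matrix is an upper-triangular square matrix of nonnegative integers in which every row and every column contains a nonzero entry; it is primitive if all entries are $0$ or $1$. Rows and columns are numbered from $1$, top to bottom and left to right. The corner cell of a $k\times k$ matrix $M$ is the top-right cell $(1,k)$. Statistics: $\mathrm{iso}(M)$ = value of the corner cell; $\min(M)$ = sum of the first row excluding the corner cell; $\max(M)$ = sum of the last column excluding the corner cell; $\mathrm{int}(M)$ = sum of all cells outside the first row and the last column. -}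

module Defs where

open import Data.Bool using (Bool; true; false; if_then_else_; not; _∧_)
open import Data.Nat as ℕ using (ℕ; zero; suc; _≡ᵇ_; _<ᵇ_)
open import Data.Fin using (Fin; toℕ)
open import Data.Vec using (Vec; []; _∷_; lookup)
open import Data.List using (List; []; _∷_; [_]; map; concatMap; allFin; filterᵇ; foldr)
open import Data.Bool.ListAction using (all; any)
open import Algebra.Bundles using (CommutativeRing)
open import Level using (Level)

vecsOver : {A : Set} → List A → (n : ℕ) → List (Vec A n)
vecsOver xs zero    = [ [] ]
vecsOver xs (suc n) = concatMap (λ a → map (a ∷_) (vecsOver xs n)) xs

-- A primitive k×k matrix: a vector of k rows, each a vector of k entries in {0,1}
-- (true = 1, false = 0). Rows/columns indexed by Fin k (index 0 = row/column 1).
Matrix : ℕ → Set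
Matrix k = Vec (Vec Bool k) k

entry : {k : ℕ} → Matrix k → Fin k → Fin k → Bool
entry M i j = lookup (lookup M i) j

allMatrices : (k : ℕ) → List (Matrix k)
allMatrices k = vecsOver (vecsOver (false ∷ true ∷ []) k) k

isFishburn : {k : ℕ} → Matrix k → Bool
isFishburn {k} M =
  all (λ i → all (λ j → if toℕ j <ᵇ toℕ i then not (entry M i j) else true) (allFin k)) (allFin k)
  ∧ all (λ i → any (λ j → entry M i j) (allFin k)) (allFin k)
  ∧ all (λ j → any (λ i → entry M i j) (allFin k)) (allFin k)

primFishburn : (k : ℕ) → List (Matrix k)
primFishburn k = filterᵇ isFishburn (allMatrices k)

val : Bool → ℕ
val true  = 1
val false = 0

sumList : List ℕ → ℕ
sumList = foldr ℕ._+_ 0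

cellSum : {k : ℕ} → Matrix k → (Bool → Bool → Bool) → ℕ
cellSum {k} M p =
  sumList (map (λ i → sumList (map (λ j →
    if p (toℕ i ≡ᵇ 0) (suc (toℕ j) ≡ᵇ k) then val (entry M i j) else 0)
    (allFin k))) (allFin k))

iso : {k : ℕ} → Matrix k → ℕ
iso M = cellSum M (λ fr lc → fr ∧ lc)

minSt : {k : ℕ} → Matrix k → ℕ
minSt M = cellSum M (λ fr lc → fr ∧ not lc)

maxSt : {k : ℕ} → Matrix k → ℕ
maxSt M = cellSum M (λ fr lc → not fr ∧ lc)

intSt : {k : ℕ} → Matrix k → ℕ
intSt M = cellSum M (λ fr lc → not fr ∧ not lc)

module _ {c ℓ : Level} (R : CommutativeRing c ℓ) where
  open CommutativeRing R

  pow : Carrier → ℕ → Carrier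
  pow a zero    = 1#
  pow a (suc n) = a * pow a n

  P : (k : ℕ) → Carrier → Carrier → Carrier → Carrier → Carrier
  P k v w x y = foldr _+_ 0#
    (map (λ M → pow x (iso M) * pow y (minSt M) * pow v (maxSt M) * pow w (intSt M))
         (primFishburn k))

module Submission where

-- The last row of a primitive (k+1)×(k+1) Fishburn matrix N is (0,…,0,1), which
-- contributes the factor v.  Let U be the other k rows and M the k×k matrix obtained
-- from U by or-ing its last two columns: N is Fishburn iff M is Fishburn and column k
-- of U is nonzero.  Over a fixed M, a row of U whose merged last entry is 1 ends in
-- 01, 10 or 11, of weights v, w and vw (x, y and xy in the first row); summing over all
-- U with M Fishburn therefore gives P_k(v+w+vw, w, x+y+xy, y), while for the U whose
-- column k is zero such rows end in 01 only, which gives P_k(v, w, x, y).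

open import Defs
open import Algebra.Bundles using (CommutativeMonoid; CommutativeRing)
import Algebra.Lattice.Properties.BooleanAlgebra as BooleanAlgebraProperties
import Algebra.Properties.AbelianGroup as AbelianGroupProperties
import Algebra.Properties.CommutativeSemigroup as CommutativeSemigroupProperties
import Algebra.Properties.Ring as RingProperties
import Algebra.Solver.Ring.NaturalCoefficients.Default as NaturalCoefficientsSolver
open import Data.Bool using (Bool; true; false; _∧_; _∨_; not; if_then_else_)
import Data.Bool.Properties as Boolₚ
open import Data.Bool.ListAction using (and; or)
open import Data.Fin using (Fin; toℕ)
open import Data.List using (List; []; _∷_; [_]; _++_; map; foldr; concatMap; filterᵇ; allFin; tabulate)
import Data.List.Properties as Listₚ
open import Data.Nat as ℕ using (ℕ; zero; suc; _≤_; _<_; z≤n; s≤s; _<ᵇ_; _≡ᵇ_)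
open import Data.Vec as Vec using (Vec; []; _∷_; _∷ʳ_; lookup; replicate; zipWith)
import Data.Vec.Properties as Vecₚ
open import Function using (_∘_)
open import Level using (Level)
import Relation.Binary.PropositionalEquality as ≡
open ≡ using (_≡_; refl; cong; cong₂)

open BooleanAlgebraProperties Boolₚ.∨-∧-booleanAlgebra using (deMorgan₂)
open CommutativeSemigroupProperties (CommutativeMonoid.commutativeSemigroup Boolₚ.∨-commutativeMonoid)
  using () renaming (interchange to ∨-interchange)

private
  variable
    a b c : Level
    A : Set a
    B : Set b
    C : Set c
    m n k : ℕ

mapWithIndex : (ℕ → A → B) → Vec A n → List B
mapWithIndex f []       = []
mapWithIndex f (x ∷ xs) = f 0 x ∷ mapWithIndex (f ∘ suc) xs

tabulate≡mapWithIndex : (f : ℕ → A → B) (xs : Vec A n) →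
                        tabulate (λ i → f (toℕ i) (lookup xs i)) ≡ mapWithIndex f xs
tabulate≡mapWithIndex f []       = refl
tabulate≡mapWithIndex f (x ∷ xs) = cong (f 0 x ∷_) (tabulate≡mapWithIndex (f ∘ suc) xs)

map-allFin : (f : ℕ → A → B) (xs : Vec A n) {g : Fin n → B} →
             (∀ i → g i ≡ f (toℕ i) (lookup xs i)) → map g (allFin n) ≡ mapWithIndex f xs
map-allFin f xs {g} g≗f = ≡.trans (Listₚ.map-tabulate (λ i → i) g)
  (≡.trans (Listₚ.tabulate-cong g≗f) (tabulate≡mapWithIndex f xs))

map-mapWithIndex : (g : B → C) (f : ℕ → A → B) (xs : Vec A n) →
                   map g (mapWithIndex f xs) ≡ mapWithIndex (λ i → g ∘ f i) xs
map-mapWithIndex g f []       = refl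
map-mapWithIndex g f (x ∷ xs) = cong (g (f 0 x) ∷_) (map-mapWithIndex g (f ∘ suc) xs)

mapWithIndex-map : (f : ℕ → B → C) (g : A → B) (xs : Vec A n) →
                   mapWithIndex f (Vec.map g xs) ≡ mapWithIndex (λ i → f i ∘ g) xs
mapWithIndex-map f g []       = refl
mapWithIndex-map f g (x ∷ xs) = cong (f 0 (g x) ∷_) (mapWithIndex-map (f ∘ suc) g xs)

mapWithIndex-cong : {f g : ℕ → A → B} (xs : Vec A n) →
                    (∀ i x → i < n → f i x ≡ g i x) → mapWithIndex f xs ≡ mapWithIndex g xs
mapWithIndex-cong []       f≗g = refl
mapWithIndex-cong (x ∷ xs) f≗g =
  cong₂ _∷_ (f≗g 0 x (s≤s z≤n)) (mapWithIndex-cong xs (λ i y i<n → f≗g (suc i) y (s≤s i<n)))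

mapWithIndex-∷ʳ : (f : ℕ → A → B) (xs : Vec A n) (x : A) →
                  mapWithIndex f (xs ∷ʳ x) ≡ mapWithIndex f xs ++ [ f n x ]
mapWithIndex-∷ʳ f []       x = refl
mapWithIndex-∷ʳ f (y ∷ xs) x = cong (f 0 y ∷_) (mapWithIndex-∷ʳ (f ∘ suc) xs x)

and-++ : (xs ys : List Bool) → and (xs ++ ys) ≡ and xs ∧ and ys
and-++ []       ys = refl
and-++ (x ∷ xs) ys = ≡.trans (cong (x ∧_) (and-++ xs ys)) (≡.sym (Boolₚ.∧-assoc x (and xs) (and ys)))

and-∷ʳ : (xs : List Bool) (x : Bool) → and (xs ++ [ x ]) ≡ and xs ∧ x
and-∷ʳ xs x = ≡.trans (and-++ xs [ x ]) (cong (and xs ∧_) (Boolₚ.∧-identityʳ x))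

merge : Vec Bool (suc (suc n)) → Vec Bool (suc n)
merge {zero}  (p ∷ q ∷ []) = (p ∨ q) ∷ []
merge {suc n} (e ∷ r)      = e ∷ merge r

penultimate : Vec Bool (suc (suc n)) → Bool
penultimate {zero}  (p ∷ _ ∷ []) = p
penultimate {suc n} (_ ∷ r)      = penultimate r

columnOr : Vec (Vec Bool n) k → Vec Bool n
columnOr []       = replicate _ false
columnOr (r ∷ rs) = zipWith _∨_ r (columnOr rs)

zerosBefore : ℕ → Vec Bool n → Bool
zerosBefore i = and ∘ mapWithIndex (λ j e → if j <ᵇ i then not e else true)

nonzero : Vec Bool n → Bool
nonzero = or ∘ mapWithIndex (λ _ e → e)

allTrue : Vec Bool n → Bool
allTrue = and ∘ mapWithIndex (λ _ e → e)

upperTriangular : Vec (Vec Bool n) k → Bool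
upperTriangular = and ∘ mapWithIndex zerosBefore

rowsNonzero : Vec (Vec Bool n) k → Bool
rowsNonzero = and ∘ mapWithIndex (λ _ → nonzero)

fishburn : Vec (Vec Bool n) k → Bool
fishburn M = upperTriangular M ∧ (rowsNonzero M ∧ allTrue (columnOr M))

lookup-columnOr : (M : Vec (Vec Bool n) k) (j : Fin n) →
                  lookup (columnOr M) j ≡ or (mapWithIndex (λ _ r → lookup r j) M)
lookup-columnOr []      j = Vecₚ.lookup-replicate j false
lookup-columnOr (r ∷ M) j =
  ≡.trans (Vecₚ.lookup-zipWith _∨_ j r (columnOr M)) (cong (lookup r j ∨_) (lookup-columnOr M j))

isFishburn≡fishburn : (M : Matrix k) → isFishburn M ≡ fishburn M
isFishburn≡fishburn M = cong₂ _∧_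
  (cong and (map-allFin zerosBefore M λ i → cong and (map-allFin _ (lookup M i) λ _ → refl)))
  (cong₂ _∧_
    (cong and (map-allFin _ M λ i → cong or (map-allFin _ (lookup M i) λ _ → refl)))
    (cong and (map-allFin _ (columnOr M) λ j →
      ≡.trans (cong or (map-allFin _ M λ _ → refl)) (≡.sym (lookup-columnOr M j)))))

zerosBefore-merge : ∀ {i} (r : Vec Bool (suc (suc n))) → i ≤ n → zerosBefore i (merge r) ≡ zerosBefore i r
zerosBefore-merge {zero}  {zero}  (p ∷ q ∷ []) _         = refl
zerosBefore-merge {suc n} {zero}  (e ∷ r)      _         = zerosBefore-merge r z≤n
zerosBefore-merge {suc n} {suc i} (e ∷ r)      (s≤s i≤n) = cong (not e ∧_) (zerosBefore-merge r i≤n)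

nonzero-merge : (r : Vec Bool (suc (suc n))) → nonzero (merge r) ≡ nonzero r
nonzero-merge {zero}  (p ∷ q ∷ []) = Boolₚ.∨-assoc p q false
nonzero-merge {suc n} (e ∷ r)      = cong (e ∨_) (nonzero-merge r)

merge-zipWith-∨ : (u w : Vec Bool (suc (suc n))) →
                  merge (zipWith _∨_ u w) ≡ zipWith _∨_ (merge u) (merge w)
merge-zipWith-∨ {zero}  (p ∷ q ∷ []) (p′ ∷ q′ ∷ []) = cong (_∷ []) (∨-interchange p p′ q q′)
merge-zipWith-∨ {suc n} (e ∷ u)      (e′ ∷ w)       = cong ((e ∨ e′) ∷_) (merge-zipWith-∨ u w)

merge-replicate : (n : ℕ) → merge (replicate (suc (suc n)) false) ≡ replicate (suc n) false
merge-replicate zero    = refl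
merge-replicate (suc n) = cong (false ∷_) (merge-replicate n)

columnOr-map-merge : (U : Vec (Vec Bool (suc (suc n))) k) → columnOr (Vec.map merge U) ≡ merge (columnOr U)
columnOr-map-merge {n} []      = ≡.sym (merge-replicate n)
columnOr-map-merge     (r ∷ U) =
  ≡.trans (cong (zipWith _∨_ (merge r)) (columnOr-map-merge U)) (≡.sym (merge-zipWith-∨ r (columnOr U)))

fishburn-map-merge : (U : Vec (Vec Bool (suc (suc m))) (suc m)) →
  fishburn (Vec.map merge U) ≡ upperTriangular U ∧ (rowsNonzero U ∧ allTrue (merge (columnOr U)))
fishburn-map-merge U = cong₂ _∧_
  (cong and (≡.trans (mapWithIndex-map zerosBefore merge U)
    (mapWithIndex-cong U λ { i r (s≤s i≤m) → zerosBefore-merge r i≤m })))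
  (cong₂ _∧_
    (cong and (≡.trans (mapWithIndex-map _ merge U) (mapWithIndex-cong U λ _ r _ → nonzero-merge r)))
    (cong allTrue (columnOr-map-merge U)))

columnOr-∷ʳ : (U : Vec (Vec Bool n) k) (r : Vec Bool n) → columnOr (U ∷ʳ r) ≡ zipWith _∨_ (columnOr U) r
columnOr-∷ʳ []      r = ≡.trans (Vecₚ.zipWith-identityʳ Boolₚ.∨-identityʳ r)
                                (≡.sym (Vecₚ.zipWith-identityˡ Boolₚ.∨-identityˡ r))
columnOr-∷ʳ (u ∷ U) r = ≡.trans (cong (zipWith _∨_ u) (columnOr-∷ʳ U r))
                                (≡.sym (Vecₚ.zipWith-assoc Boolₚ.∨-assoc u (columnOr U) r))

fishburn-∷ʳ : (U : Vec (Vec Bool n) k) (r : Vec Bool n) →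
  fishburn (U ∷ʳ r) ≡ (upperTriangular U ∧ zerosBefore k r)
                      ∧ ((rowsNonzero U ∧ nonzero r) ∧ allTrue (zipWith _∨_ (columnOr U) r))
fishburn-∷ʳ {k = k} U r = cong₂ _∧_
  (≡.trans (cong and (mapWithIndex-∷ʳ zerosBefore U r)) (and-∷ʳ (mapWithIndex zerosBefore U) (zerosBefore k r)))
  (cong₂ _∧_
    (≡.trans (cong and (mapWithIndex-∷ʳ _ U r)) (and-∷ʳ (mapWithIndex (λ _ → nonzero) U) (nonzero r)))
    (cong allTrue (columnOr-∷ʳ U r)))

zerosBefore-replicate-∷ʳ : (n : ℕ) (e : Bool) → zerosBefore n (replicate n false ∷ʳ e) ≡ true
zerosBefore-replicate-∷ʳ zero    e = refl
zerosBefore-replicate-∷ʳ (suc n) e = zerosBefore-replicate-∷ʳ n e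

nonzero-replicate-∷ʳ : (n : ℕ) (e : Bool) → nonzero (replicate n false ∷ʳ e) ≡ e
nonzero-replicate-∷ʳ zero    e = Boolₚ.∨-identityʳ e
nonzero-replicate-∷ʳ (suc n) e = nonzero-replicate-∷ʳ n e

allTrue-∨-unitRow : (u : Vec Bool (suc (suc n))) →
  allTrue (zipWith _∨_ u (replicate (suc n) false ∷ʳ true)) ≡ allTrue (merge u) ∧ penultimate u
allTrue-∨-unitRow {zero}  (true  ∷ true  ∷ []) = refl
allTrue-∨-unitRow {zero}  (true  ∷ false ∷ []) = refl
allTrue-∨-unitRow {zero}  (false ∷ true  ∷ []) = refl
allTrue-∨-unitRow {zero}  (false ∷ false ∷ []) = refl
allTrue-∨-unitRow {suc n} (true  ∷ u)          = allTrue-∨-unitRow u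
allTrue-∨-unitRow {suc n} (false ∷ u)          = refl

fishburn-∷ʳ-unitRow : (U : Vec (Vec Bool (suc (suc m))) (suc m)) →
  fishburn (U ∷ʳ (replicate (suc m) false ∷ʳ true)) ≡ fishburn (Vec.map merge U) ∧ penultimate (columnOr U)
fishburn-∷ʳ-unitRow {m} U
  rewrite fishburn-∷ʳ U (replicate (suc m) false ∷ʳ true)
        | zerosBefore-replicate-∷ʳ (suc m) true
        | nonzero-replicate-∷ʳ (suc m) true
        | allTrue-∨-unitRow (columnOr U)
        | fishburn-map-merge U
  = reassociate (upperTriangular U) (rowsNonzero U)
  where
  reassociate : ∀ a b {c s} → (a ∧ true) ∧ ((b ∧ true) ∧ (c ∧ s)) ≡ (a ∧ (b ∧ c)) ∧ s
  reassociate true  true  = refl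
  reassociate true  false = refl
  reassociate false b     = refl

fishburn-∷ʳ-zeroRow : (U : Vec (Vec Bool (suc n)) k) → fishburn (U ∷ʳ (replicate n false ∷ʳ false)) ≡ false
fishburn-∷ʳ-zeroRow {n} U
  rewrite fishburn-∷ʳ U (replicate n false ∷ʳ false)
        | nonzero-replicate-∷ʳ n false
        | Boolₚ.∧-zeroʳ (rowsNonzero U)
  = Boolₚ.∧-zeroʳ _

fishburn-∷ʳ-notZerosBefore : (U : Vec (Vec Bool n) k) (r : Vec Bool n) →
                             zerosBefore k r ≡ false → fishburn (U ∷ʳ r) ≡ false
fishburn-∷ʳ-notZerosBefore U r z≡false
  rewrite fishburn-∷ʳ U r | z≡false | Boolₚ.∧-zeroʳ (upperTriangular U) = refl

penultimate-zipWith-∨ : (u w : Vec Bool (suc (suc n))) →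
                        penultimate (zipWith _∨_ u w) ≡ penultimate u ∨ penultimate w
penultimate-zipWith-∨ {zero}  (p ∷ _ ∷ []) (p′ ∷ _ ∷ []) = refl
penultimate-zipWith-∨ {suc n} (_ ∷ u)      (_ ∷ w)       = penultimate-zipWith-∨ u w

penultimate-replicate : (n : ℕ) → penultimate (replicate (suc (suc n)) false) ≡ false
penultimate-replicate zero    = refl
penultimate-replicate (suc n) = penultimate-replicate n

not-penultimate-columnOr : (U : Vec (Vec Bool (suc (suc n))) k) →
  not (penultimate (columnOr U)) ≡ and (mapWithIndex (λ _ → not ∘ penultimate) U)
not-penultimate-columnOr {n} []      = cong not (penultimate-replicate n)
not-penultimate-columnOr     (r ∷ U) = ≡.trans (cong not (penultimate-zipWith-∨ r (columnOr U)))
  (≡.trans (deMorgan₂ (penultimate r) _) (cong (not (penultimate r) ∧_) (not-penultimate-columnOr U)))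

bits : List Bool
bits = false ∷ true ∷ []

bitVectors : (n : ℕ) → List (Vec Bool n)
bitVectors = vecsOver bits

module RingSums {c ℓ} (R : CommutativeRing c ℓ) where
  open CommutativeRing R hiding (zero) renaming (refl to ≈-refl)
  open import Relation.Binary.Reasoning.Setoid setoid
  open CommutativeSemigroupProperties +-commutativeSemigroup using () renaming (interchange to +-interchange)
  open CommutativeSemigroupProperties *-commutativeSemigroup using (x∙yz≈y∙xz) renaming (interchange to *-interchange)
  open AbelianGroupProperties +-abelianGroup using (x≈z//y)

  -- In this form P R k v w x y is literally a ∑ over primFishburn k.
  ∑ : List A → (A → Carrier) → Carrier
  ∑ xs f = foldr _+_ 0# (map f xs)

  ∑-cong : (xs : List A) {f g : A → Carrier} → (∀ x → f x ≈ g x) → ∑ xs f ≈ ∑ xs g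
  ∑-cong []       f≈g = ≈-refl
  ∑-cong (x ∷ xs) f≈g = +-cong (f≈g x) (∑-cong xs f≈g)

  ∑-zero : (xs : List A) {f : A → Carrier} → (∀ x → f x ≈ 0#) → ∑ xs f ≈ 0#
  ∑-zero []       f≈0 = ≈-refl
  ∑-zero (x ∷ xs) f≈0 = trans (+-cong (f≈0 x) (∑-zero xs f≈0)) (+-identityˡ 0#)

  ∑-+ : (xs : List A) (f g : A → Carrier) → ∑ xs (λ x → f x + g x) ≈ ∑ xs f + ∑ xs g
  ∑-+ []       f g = sym (+-identityˡ 0#)
  ∑-+ (x ∷ xs) f g = trans (+-congˡ (∑-+ xs f g)) (+-interchange (f x) (g x) (∑ xs f) (∑ xs g))

  ∑-*ˡ : (xs : List A) (a : Carrier) (f : A → Carrier) → ∑ xs (λ x → a * f x) ≈ a * ∑ xs f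
  ∑-*ˡ []       a f = sym (zeroʳ a)
  ∑-*ˡ (x ∷ xs) a f = trans (+-congˡ (∑-*ˡ xs a f)) (sym (distribˡ a (f x) (∑ xs f)))

  ∑-*-pull : (xs : List A) (a : Carrier) (f g : A → Carrier) →
             ∑ xs (λ x → f x * (a * g x)) ≈ a * ∑ xs (λ x → f x * g x)
  ∑-*-pull xs a f g = trans (∑-cong xs λ x → x∙yz≈y∙xz (f x) a (g x)) (∑-*ˡ xs a (λ x → f x * g x))

  ∑-++ : (xs ys : List A) (f : A → Carrier) → ∑ (xs ++ ys) f ≈ ∑ xs f + ∑ ys f
  ∑-++ []       ys f = sym (+-identityˡ _)
  ∑-++ (x ∷ xs) ys f = trans (+-congˡ (∑-++ xs ys f)) (sym (+-assoc _ _ _))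

  ∑-map : (h : A → B) (xs : List A) (f : B → Carrier) → ∑ (map h xs) f ≡ ∑ xs (f ∘ h)
  ∑-map h xs f = cong (foldr _+_ 0#) (≡.sym (Listₚ.map-∘ xs))

  ∑-concatMap : (g : A → List B) (xs : List A) (f : B → Carrier) →
                ∑ (concatMap g xs) f ≈ ∑ xs (λ x → ∑ (g x) f)
  ∑-concatMap g []       f = ≈-refl
  ∑-concatMap g (x ∷ xs) f = trans (∑-++ (g x) (concatMap g xs) f) (+-congˡ (∑-concatMap g xs f))

  ∑-vecsOver-∷ : {A : Set} (xs : List A) (n : ℕ) (f : Vec A (suc n) → Carrier) →
                 ∑ (vecsOver xs (suc n)) f ≈ ∑ xs (λ x → ∑ (vecsOver xs n) (λ u → f (x ∷ u)))
  ∑-vecsOver-∷ xs n f = trans (∑-concatMap _ xs f)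
    (∑-cong xs λ x → reflexive (∑-map (x ∷_) (vecsOver xs n) f))

  ∑-vecsOver-∷ʳ : {A : Set} (xs : List A) (n : ℕ) (f : Vec A (suc n) → Carrier) →
                  ∑ (vecsOver xs (suc n)) f ≈ ∑ (vecsOver xs n) (λ u → ∑ xs (λ x → f (u ∷ʳ x)))
  ∑-vecsOver-∷ʳ xs zero    f = trans (∑-vecsOver-∷ xs zero f)
    (trans (∑-cong xs λ _ → +-identityʳ _) (sym (+-identityʳ _)))
  ∑-vecsOver-∷ʳ xs (suc n) f = begin
    ∑ (vecsOver xs (suc (suc n))) f
      ≈⟨ ∑-vecsOver-∷ xs (suc n) f ⟩
    ∑ xs (λ x → ∑ (vecsOver xs (suc n)) (λ u → f (x ∷ u)))
      ≈⟨ ∑-cong xs (λ x → ∑-vecsOver-∷ʳ xs n (λ u → f (x ∷ u))) ⟩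
    ∑ xs (λ x → ∑ (vecsOver xs n) (λ u → ∑ xs (λ y → f (x ∷ (u ∷ʳ y)))))
      ≈⟨ ∑-vecsOver-∷ xs n (λ u → ∑ xs (λ y → f (u ∷ʳ y))) ⟨
    ∑ (vecsOver xs (suc n)) (λ u → ∑ xs (λ y → f (u ∷ʳ y))) ∎

  𝟙 : Bool → Carrier
  𝟙 true  = 1#
  𝟙 false = 0#

  𝟙-∧ : ∀ p q → 𝟙 (p ∧ q) ≈ 𝟙 p * 𝟙 q
  𝟙-∧ true  q = sym (*-identityˡ _)
  𝟙-∧ false q = sym (zeroˡ _)

  𝟙-∧-complement : ∀ p q → 𝟙 (p ∧ q) + 𝟙 (p ∧ not q) ≈ 𝟙 p
  𝟙-∧-complement true  true  = +-identityʳ 1#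
  𝟙-∧-complement true  false = +-identityˡ 1#
  𝟙-∧-complement false q     = +-identityʳ 0#

  ∑-filterᵇ : (p : A → Bool) (xs : List A) (f : A → Carrier) →
              ∑ (filterᵇ p xs) f ≈ ∑ xs (λ x → 𝟙 (p x) * f x)
  ∑-filterᵇ p []       f = ≈-refl
  ∑-filterᵇ p (x ∷ xs) f with p x
  ... | true  = +-cong (sym (*-identityˡ (f x))) (∑-filterᵇ p xs f)
  ... | false = trans (sym (+-identityˡ _)) (+-cong (sym (zeroˡ (f x))) (∑-filterᵇ p xs f))

  ∑-𝟙-∧ : (xs : List A) (p q : A → Bool) (f : A → Carrier) →
          ∑ xs (λ x → 𝟙 (p x ∧ q x) * f x)
            ≈ ∑ xs (λ x → 𝟙 (p x) * f x) - ∑ xs (λ x → 𝟙 (p x ∧ not (q x)) * f x)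
  ∑-𝟙-∧ xs p q f = x≈z//y _ _ _ (begin
    ∑ xs (λ x → 𝟙 (p x ∧ q x) * f x) + ∑ xs (λ x → 𝟙 (p x ∧ not (q x)) * f x)
      ≈⟨ ∑-+ xs _ _ ⟨
    ∑ xs (λ x → 𝟙 (p x ∧ q x) * f x + 𝟙 (p x ∧ not (q x)) * f x)
      ≈⟨ ∑-cong xs (λ x → trans (sym (distribʳ (f x) _ _)) (*-congʳ (𝟙-∧-complement (p x) (q x)))) ⟩
    ∑ xs (λ x → 𝟙 (p x) * f x) ∎)

  ∏ : List Carrier → Carrier
  ∏ = foldr _*_ 1#

  ∏-∷ʳ : (xs : List Carrier) (x : Carrier) → ∏ (xs ++ [ x ]) ≈ ∏ xs * x
  ∏-∷ʳ []       x = trans (*-identityʳ x) (sym (*-identityˡ x))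
  ∏-∷ʳ (y ∷ xs) x = trans (*-congˡ (∏-∷ʳ xs x)) (sym (*-assoc y (∏ xs) x))

  ∏-mapWithIndex-cong : {f g : ℕ → A → Carrier} (xs : Vec A n) →
                        (∀ i x → f i x ≈ g i x) → ∏ (mapWithIndex f xs) ≈ ∏ (mapWithIndex g xs)
  ∏-mapWithIndex-cong []       f≈g = ≈-refl
  ∏-mapWithIndex-cong (x ∷ xs) f≈g = *-cong (f≈g 0 x) (∏-mapWithIndex-cong xs (f≈g ∘ suc))

  ∏-mapWithIndex-* : (f g : ℕ → A → Carrier) (xs : Vec A n) →
    ∏ (mapWithIndex f xs) * ∏ (mapWithIndex g xs) ≈ ∏ (mapWithIndex (λ i x → f i x * g i x) xs)
  ∏-mapWithIndex-* f g []       = *-identityˡ 1#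
  ∏-mapWithIndex-* f g (x ∷ xs) = trans (*-interchange (f 0 x) _ (g 0 x) _)
    (*-congˡ (∏-mapWithIndex-* (f ∘ suc) (g ∘ suc) xs))

  𝟙-and : (bs : List Bool) → 𝟙 (and bs) ≈ ∏ (map 𝟙 bs)
  𝟙-and []       = ≈-refl
  𝟙-and (b ∷ bs) = trans (𝟙-∧ b (and bs)) (*-congˡ (𝟙-and bs))

  𝟙-and-mapWithIndex-* : (p : ℕ → A → Bool) (f : ℕ → A → Carrier) (xs : Vec A n) →
    𝟙 (and (mapWithIndex p xs)) * ∏ (mapWithIndex f xs) ≈ ∏ (mapWithIndex (λ i x → 𝟙 (p i x) * f i x) xs)
  𝟙-and-mapWithIndex-* p f xs = trans
    (*-congʳ (trans (𝟙-and (mapWithIndex p xs)) (reflexive (cong ∏ (map-mapWithIndex 𝟙 p xs)))))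
    (∏-mapWithIndex-* _ f xs)

  ∑-vecsOver-map : {A B : Set} (bs : List B) (as : List A) (ψ : B → A)
    (ρ : ℕ → B → Carrier) (σ : ℕ → A → Carrier) →
    (∀ t (H : A → Carrier) → ∑ bs (λ b → H (ψ b) * ρ t b) ≈ ∑ as (λ a → H a * σ t a)) →
    (G : Vec A k → Carrier) →
    ∑ (vecsOver bs k) (λ U → G (Vec.map ψ U) * ∏ (mapWithIndex ρ U))
      ≈ ∑ (vecsOver as k) (λ M → G M * ∏ (mapWithIndex σ M))
  ∑-vecsOver-map {k = zero}  bs as ψ ρ σ rows≈ G = ≈-refl
  ∑-vecsOver-map {k = suc k} {A = A} bs as ψ ρ σ rows≈ G = begin
    ∑ (vecsOver bs (suc k)) (λ U → G (Vec.map ψ U) * ∏ (mapWithIndex ρ U))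
      ≈⟨ ∑-vecsOver-∷ bs k _ ⟩
    ∑ bs (λ b → ∑ (vecsOver bs k) (λ U → G (ψ b ∷ Vec.map ψ U) * (ρ 0 b * ∏ (mapWithIndex (ρ ∘ suc) U))))
      ≈⟨ ∑-cong bs (λ b → ∑-*-pull (vecsOver bs k) (ρ 0 b)
                              (G ∘ (ψ b ∷_) ∘ Vec.map ψ) (∏ ∘ mapWithIndex (ρ ∘ suc))) ⟩
    ∑ bs (λ b → ρ 0 b * ∑ (vecsOver bs k) (λ U → G (ψ b ∷ Vec.map ψ U) * ∏ (mapWithIndex (ρ ∘ suc) U)))
      ≈⟨ ∑-cong bs (λ b → trans
           (*-congˡ {ρ 0 b} (∑-vecsOver-map bs as ψ (ρ ∘ suc) (σ ∘ suc) (rows≈ ∘ suc) (G ∘ (ψ b ∷_))))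
           (*-comm _ _)) ⟩
    ∑ bs (λ b → K (ψ b) * ρ 0 b)
      ≈⟨ rows≈ 0 K ⟩
    ∑ as (λ a → K a * σ 0 a)
      ≈⟨ ∑-cong as (λ a → trans (*-comm _ _)
           (sym (∑-*-pull (vecsOver as k) (σ 0 a) (G ∘ (a ∷_)) (∏ ∘ mapWithIndex (σ ∘ suc))))) ⟩
    ∑ as (λ a → ∑ (vecsOver as k) (λ M → G (a ∷ M) * (σ 0 a * ∏ (mapWithIndex (σ ∘ suc) M))))
      ≈⟨ ∑-vecsOver-∷ as k _ ⟨
    ∑ (vecsOver as (suc k)) (λ M → G M * ∏ (mapWithIndex σ M)) ∎
    where
    K : A → Carrier
    K a = ∑ (vecsOver as k) (λ M → G (a ∷ M) * ∏ (mapWithIndex (σ ∘ suc) M))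

  ∑-zerosBefore : (n : ℕ) (H : Vec Bool (suc n) → Carrier) → (∀ r → zerosBefore n r ≡ false → H r ≈ 0#) →
    ∑ (bitVectors (suc n)) H ≈ H (replicate n false ∷ʳ false) + H (replicate n false ∷ʳ true)
  ∑-zerosBefore zero    H H≈0 = +-congˡ (+-identityʳ _)
  ∑-zerosBefore (suc n) H H≈0 = begin
    ∑ (bitVectors (2 ℕ.+ n)) H
      ≈⟨ ∑-vecsOver-∷ bits (suc n) H ⟩
    ∑ (bitVectors (suc n)) (H ∘ (false ∷_)) + (∑ (bitVectors (suc n)) (H ∘ (true ∷_)) + 0#)
      ≈⟨ +-cong (∑-zerosBefore n (H ∘ (false ∷_)) (H≈0 ∘ (false ∷_)))
                (trans (+-identityʳ _) (∑-zero (bitVectors (suc n)) λ r → H≈0 (true ∷ r) ≡.refl)) ⟩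
    H (replicate (suc n) false ∷ʳ false) + H (replicate (suc n) false ∷ʳ true) + 0#
      ≈⟨ +-identityʳ _ ⟩
    H (replicate (suc n) false ∷ʳ false) + H (replicate (suc n) false ∷ʳ true) ∎

module FishburnWeights {c ℓ} (R : CommutativeRing c ℓ) where
  open CommutativeRing R hiding (zero) renaming (refl to ≈-refl)
  open import Relation.Binary.Reasoning.Setoid setoid
  open CommutativeSemigroupProperties *-commutativeSemigroup using (x∙yz≈y∙xz; x∙yz≈z∙xy)
  open NaturalCoefficientsSolver commutativeSemiring using (solve; _:=_; _:+_; _:*_; con)
  open RingSums R

  cell : Carrier → Bool → Carrier
  cell a true  = a
  cell a false = 1#

  rowWeight : (Bool → Carrier) → (Bool → Carrier) → Vec Bool (suc n) → Carrier
  rowWeight {zero}  inner last (e ∷ []) = last e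
  rowWeight {suc n} inner last (e ∷ r)  = inner e * rowWeight inner last r

  rowWeight₂ : (Bool → Carrier) → (Bool → Bool → Carrier) → Vec Bool (suc (suc n)) → Carrier
  rowWeight₂ {zero}  inner lastTwo (p ∷ q ∷ []) = lastTwo p q
  rowWeight₂ {suc n} inner lastTwo (e ∷ r)      = inner e * rowWeight₂ inner lastTwo r

  rowWeight≡rowWeight₂ : (inner last : Bool → Carrier) (r : Vec Bool (suc (suc n))) →
                         rowWeight inner last r ≡ rowWeight₂ inner (λ p q → inner p * last q) r
  rowWeight≡rowWeight₂ {zero}  inner last (p ∷ q ∷ []) = ≡.refl
  rowWeight≡rowWeight₂ {suc n} inner last (e ∷ r)      = cong (inner e *_) (rowWeight≡rowWeight₂ inner last r)

  𝟙-not-penultimate-rowWeight : (inner last : Bool → Carrier) (r : Vec Bool (suc (suc n))) →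
    𝟙 (not (penultimate r)) * rowWeight inner last r
      ≈ rowWeight₂ inner (λ p q → 𝟙 (not p) * (inner p * last q)) r
  𝟙-not-penultimate-rowWeight {zero}  inner last (p ∷ q ∷ []) = ≈-refl
  𝟙-not-penultimate-rowWeight {suc n} inner last (e ∷ r)      =
    trans (x∙yz≈y∙xz _ (inner e) _) (*-congˡ (𝟙-not-penultimate-rowWeight inner last r))

  rowWeight-unitRow : (a : Carrier) (last : Bool → Carrier) (n : ℕ) (e : Bool) →
                      rowWeight (cell a) last (replicate n false ∷ʳ e) ≈ last e
  rowWeight-unitRow a last zero    e = ≈-refl
  rowWeight-unitRow a last (suc n) e = trans (*-identityˡ _) (rowWeight-unitRow a last n e)

  ∑-merge : (inner : Bool → Carrier) (lastTwo : Bool → Bool → Carrier) (last : Bool → Carrier) →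
            lastTwo false false ≈ last false →
            lastTwo false true + (lastTwo true false + lastTwo true true) ≈ last true →
            (H : Vec Bool (suc n) → Carrier) →
            ∑ (bitVectors (suc (suc n))) (λ r → H (merge r) * rowWeight₂ inner lastTwo r)
              ≈ ∑ (bitVectors (suc n)) (λ r → H r * rowWeight inner last r)
  ∑-merge {zero} inner lastTwo last ff≈ fused≈ H = +-cong (*-congˡ ff≈) (begin
    H₁ * lastTwo false true + (H₁ * lastTwo true false + (H₁ * lastTwo true true + 0#))
      ≈⟨ +-congˡ (+-congˡ (+-identityʳ _)) ⟩
    H₁ * lastTwo false true + (H₁ * lastTwo true false + H₁ * lastTwo true true)
      ≈⟨ trans (+-congˡ (sym (distribˡ H₁ _ _))) (sym (distribˡ H₁ _ _)) ⟩
    H₁ * (lastTwo false true + (lastTwo true false + lastTwo true true))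
      ≈⟨ *-congˡ fused≈ ⟩
    H₁ * last true
      ≈⟨ +-identityʳ _ ⟨
    H₁ * last true + 0# ∎)
    where
    H₁ : Carrier
    H₁ = H (true ∷ [])
  ∑-merge {suc n} inner lastTwo last ff≈ fused≈ H = begin
    ∑ (bitVectors (3 ℕ.+ n)) (λ r → H (merge r) * rowWeight₂ inner lastTwo r)
      ≈⟨ ∑-vecsOver-∷ bits (suc (suc n)) _ ⟩
    ∑ bits (λ e → ∑ (bitVectors (2 ℕ.+ n)) (λ r → H (e ∷ merge r) * (inner e * rowWeight₂ inner lastTwo r)))
      ≈⟨ ∑-cong bits (λ e → ∑-*-pull (bitVectors (2 ℕ.+ n)) (inner e) (H ∘ (e ∷_) ∘ merge) (rowWeight₂ inner lastTwo)) ⟩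
    ∑ bits (λ e → inner e * ∑ (bitVectors (2 ℕ.+ n)) (λ r → H (e ∷ merge r) * rowWeight₂ inner lastTwo r))
      ≈⟨ ∑-cong bits (λ e → *-congˡ {inner e} (∑-merge inner lastTwo last ff≈ fused≈ (H ∘ (e ∷_)))) ⟩
    ∑ bits (λ e → inner e * ∑ (bitVectors (suc n)) (λ r → H (e ∷ r) * rowWeight inner last r))
      ≈⟨ ∑-cong bits (λ e → ∑-*-pull (bitVectors (suc n)) (inner e) (H ∘ (e ∷_)) (rowWeight inner last)) ⟨
    ∑ bits (λ e → ∑ (bitVectors (suc n)) (λ r → H (e ∷ r) * (inner e * rowWeight inner last r)))
      ≈⟨ ∑-vecsOver-∷ bits (suc n) _ ⟨
    ∑ (bitVectors (2 ℕ.+ n)) (λ r → H r * rowWeight inner last r) ∎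

  ∑-merge-cell : (β α : Carrier) (H : Vec Bool (suc n) → Carrier) →
    ∑ (bitVectors (suc (suc n))) (λ r → H (merge r) * rowWeight (cell β) (cell α) r)
      ≈ ∑ (bitVectors (suc n)) (λ r → H r * rowWeight (cell β) (cell (α + β + α * β)) r)
  ∑-merge-cell {n} β α H = trans
    (∑-cong (bitVectors (suc (suc n))) λ r → *-congˡ (reflexive (rowWeight≡rowWeight₂ (cell β) (cell α) r)))
    (∑-merge (cell β) (λ p q → cell β p * cell α q) (cell (α + β + α * β)) (*-identityˡ 1#) fused H)
    where
    fused : 1# * α + (β * 1# + β * α) ≈ α + β + α * β
    fused = solve 2 (λ α β → con 1 :* α :+ (β :* con 1 :+ β :* α) := α :+ β :+ α :* β) ≈-refl α β

  ∑-merge-penultimateZero : (β : Carrier) (last : Bool → Carrier) (H : Vec Bool (suc n) → Carrier) →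
    ∑ (bitVectors (suc (suc n))) (λ r → H (merge r) * (𝟙 (not (penultimate r)) * rowWeight (cell β) last r))
      ≈ ∑ (bitVectors (suc n)) (λ r → H r * rowWeight (cell β) last r)
  ∑-merge-penultimateZero {n} β last H = trans
    (∑-cong (bitVectors (suc (suc n))) λ r → *-congˡ (𝟙-not-penultimate-rowWeight (cell β) last r))
    (∑-merge (cell β) (λ p q → 𝟙 (not p) * (cell β p * last q)) last (unit false) fused H)
    where
    unit : ∀ e → 1# * (1# * last e) ≈ last e
    unit e = trans (*-identityˡ _) (*-identityˡ _)
    fused : 1# * (1# * last true) + (0# * (β * last false) + 0# * (β * last true)) ≈ last true
    fused = trans (+-cong (unit true) (trans (+-cong (zeroˡ _) (zeroˡ _)) (+-identityˡ 0#))) (+-identityʳ _)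

  pow-+ : (a : Carrier) (m n : ℕ) → pow R a (m ℕ.+ n) ≈ pow R a m * pow R a n
  pow-+ a zero    n = sym (*-identityˡ _)
  pow-+ a (suc m) n = trans (*-congˡ (pow-+ a m n)) (sym (*-assoc _ _ _))

  pow-sumList-mapWithIndex : (a : Carrier) (f : ℕ → A → ℕ) (xs : Vec A n) →
    pow R a (sumList (mapWithIndex f xs)) ≈ ∏ (mapWithIndex (λ i x → pow R a (f i x)) xs)
  pow-sumList-mapWithIndex a f []       = ≈-refl
  pow-sumList-mapWithIndex a f (x ∷ xs) =
    trans (pow-+ a (f 0 x) _) (*-congˡ (pow-sumList-mapWithIndex a (f ∘ suc) xs))

  pow-val : (a : Carrier) (e : Bool) → pow R a (val e) ≈ cell a e
  pow-val a true  = *-identityʳ a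
  pow-val a false = ≈-refl

  ∏∏ : (ℕ → ℕ → Bool → Carrier) → Vec (Vec Bool n) k → Carrier
  ∏∏ f = ∏ ∘ mapWithIndex (λ t → ∏ ∘ mapWithIndex (f t))

  ∏∏-* : (f g : ℕ → ℕ → Bool → Carrier) (M : Vec (Vec Bool n) k) →
         ∏∏ f M * ∏∏ g M ≈ ∏∏ (λ t s e → f t s e * g t s e) M
  ∏∏-* f g M = trans (∏-mapWithIndex-* _ _ M) (∏-mapWithIndex-cong M λ t r → ∏-mapWithIndex-* (f t) (g t) r)

  pow-cellSum : (a : Carrier) (M : Matrix k) (p : Bool → Bool → Bool) →
    pow R a (cellSum M p) ≈ ∏∏ (λ t s e → pow R a (if p (t ≡ᵇ 0) (suc s ≡ᵇ k) then val e else 0)) M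
  pow-cellSum {k} a M p = trans
    (reflexive (cong (pow R a ∘ sumList)
      (map-allFin rowSum M λ i → cong sumList (map-allFin (exponent (toℕ i)) (lookup M i) λ _ → ≡.refl))))
    (trans (pow-sumList-mapWithIndex a rowSum M)
      (∏-mapWithIndex-cong M λ t r → pow-sumList-mapWithIndex a (exponent t) r))
    where
    exponent : ℕ → ℕ → Bool → ℕ
    exponent t s e = if p (t ≡ᵇ 0) (suc s ≡ᵇ k) then val e else 0
    rowSum : ℕ → Vec Bool k → ℕ
    rowSum t = sumList ∘ mapWithIndex (exponent t)

  ∏-mapWithIndex-last : (f : Bool → Bool → Carrier) (r : Vec Bool (suc n)) →
    ∏ (mapWithIndex (λ s → f (suc s ≡ᵇ suc n)) r) ≈ rowWeight (f false) (f true) r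
  ∏-mapWithIndex-last {zero}  f (e ∷ []) = *-identityʳ _
  ∏-mapWithIndex-last {suc n} f (e ∷ r)  = *-congˡ (∏-mapWithIndex-last f r)

  fishburnCell : (v w x y : Carrier) (firstRow lastColumn : Bool) → Bool → Carrier
  fishburnCell v w x y true  true  = cell x
  fishburnCell v w x y true  false = cell y
  fishburnCell v w x y false true  = cell v
  fishburnCell v w x y false false = cell w

  fishburnRow : (v w x y : Carrier) → ℕ → Vec Bool (suc n) → Carrier
  fishburnRow v w x y t = rowWeight (fishburnCell v w x y (t ≡ᵇ 0) false) (fishburnCell v w x y (t ≡ᵇ 0) true)

  weight : (v w x y : Carrier) → Vec (Vec Bool (suc n)) k → Carrier
  weight v w x y = ∏ ∘ mapWithIndex (fishburnRow v w x y)

  cellStatistics : (v w x y : Carrier) (firstRow lastColumn e : Bool) → Carrier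
  cellStatistics v w x y firstRow lastColumn e =
    pow R x (if firstRow ∧ lastColumn then val e else 0)
      * pow R y (if firstRow ∧ not lastColumn then val e else 0)
      * pow R v (if not firstRow ∧ lastColumn then val e else 0)
      * pow R w (if not firstRow ∧ not lastColumn then val e else 0)

  pow-statistics : (v w x y : Carrier) (M : Matrix k) →
    pow R x (iso M) * pow R y (minSt M) * pow R v (maxSt M) * pow R w (intSt M)
      ≈ ∏∏ (λ t s → cellStatistics v w x y (t ≡ᵇ 0) (suc s ≡ᵇ k)) M
  pow-statistics v w x y M = trans
    (*-cong (*-cong (*-cong (pow-cellSum x M (λ fr lc → fr ∧ lc)) (pow-cellSum y M (λ fr lc → fr ∧ not lc)))
                    (pow-cellSum v M (λ fr lc → not fr ∧ lc)))
            (pow-cellSum w M (λ fr lc → not fr ∧ not lc)))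
    (trans (*-congʳ (trans (*-congʳ (∏∏-* _ _ M)) (∏∏-* _ _ M))) (∏∏-* _ _ M))

  cellStatistics≈fishburnCell : (v w x y : Carrier) (firstRow lastColumn e : Bool) →
    cellStatistics v w x y firstRow lastColumn e ≈ fishburnCell v w x y firstRow lastColumn e
  cellStatistics≈fishburnCell v w x y true  true  e =
    trans (*-identityʳ _) (trans (*-identityʳ _) (trans (*-identityʳ _) (pow-val x e)))
  cellStatistics≈fishburnCell v w x y true  false e =
    trans (*-identityʳ _) (trans (*-identityʳ _) (trans (*-identityˡ _) (pow-val y e)))
  cellStatistics≈fishburnCell v w x y false true  e =
    trans (*-identityʳ _) (trans (*-congʳ (*-identityˡ 1#)) (trans (*-identityˡ _) (pow-val v e)))
  cellStatistics≈fishburnCell v w x y false false e =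
    trans (*-congʳ (trans (*-identityʳ _) (*-identityˡ 1#))) (trans (*-identityˡ _) (pow-val w e))

  weight-statistics : (v w x y : Carrier) (M : Matrix (suc n)) →
    pow R x (iso M) * pow R y (minSt M) * pow R v (maxSt M) * pow R w (intSt M) ≈ weight v w x y M
  weight-statistics {n} v w x y M = begin
    pow R x (iso M) * pow R y (minSt M) * pow R v (maxSt M) * pow R w (intSt M)
      ≈⟨ pow-statistics v w x y M ⟩
    ∏∏ (λ t s → cellStatistics v w x y (t ≡ᵇ 0) (suc s ≡ᵇ suc n)) M
      ≈⟨ ∏-mapWithIndex-cong M (λ t r → ∏-mapWithIndex-cong r λ s →
           cellStatistics≈fishburnCell v w x y (t ≡ᵇ 0) (suc s ≡ᵇ suc n)) ⟩
    ∏∏ (λ t s → fishburnCell v w x y (t ≡ᵇ 0) (suc s ≡ᵇ suc n)) M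
      ≈⟨ ∏-mapWithIndex-cong M (λ t r → ∏-mapWithIndex-last (fishburnCell v w x y (t ≡ᵇ 0)) r) ⟩
    weight v w x y M ∎

  P-as-sum : (n : ℕ) (v w x y : Carrier) →
    P R (suc n) v w x y ≈ ∑ (allMatrices (suc n)) (λ M → 𝟙 (fishburn M) * weight v w x y M)
  P-as-sum n v w x y = trans (∑-filterᵇ isFishburn (allMatrices (suc n)) _)
    (∑-cong (allMatrices (suc n)) λ M →
      *-cong (reflexive (cong 𝟙 (isFishburn≡fishburn M))) (weight-statistics v w x y M))

  weight-∷ʳ : (v w x y : Carrier) (U : Vec (Vec Bool (suc n)) k) (r : Vec Bool (suc n)) →
              weight v w x y (U ∷ʳ r) ≈ weight v w x y U * fishburnRow v w x y k r
  weight-∷ʳ v w x y U r = trans (reflexive (cong ∏ (mapWithIndex-∷ʳ (fishburnRow v w x y) U r)))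
                                (∏-∷ʳ (mapWithIndex (fishburnRow v w x y) U) _)

  ∑-lastRow : (v w x y : Carrier) (U : Vec (Vec Bool (suc (suc m))) (suc m)) →
    ∑ (bitVectors (suc (suc m))) (λ r → 𝟙 (fishburn (U ∷ʳ r)) * weight v w x y (U ∷ʳ r))
      ≈ v * (𝟙 (fishburn (Vec.map merge U) ∧ penultimate (columnOr U)) * weight v w x y U)
  ∑-lastRow {m} v w x y U = begin
    ∑ (bitVectors (suc (suc m))) H
      ≈⟨ ∑-zerosBefore (suc m) H (λ r → vanish ∘ fishburn-∷ʳ-notZerosBefore U r) ⟩
    H (replicate (suc m) false ∷ʳ false) + H unitRow
      ≈⟨ +-cong (vanish (fishburn-∷ʳ-zeroRow U))
                (*-cong (reflexive (cong 𝟙 (fishburn-∷ʳ-unitRow U))) (weight-∷ʳ v w x y U unitRow)) ⟩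
    0# + 𝟙 (F ∧ s) * (weight v w x y U * rowWeight (cell w) (cell v) unitRow)
      ≈⟨ trans (+-identityˡ _) (*-congˡ (*-congˡ (rowWeight-unitRow w (cell v) (suc m) true))) ⟩
    𝟙 (F ∧ s) * (weight v w x y U * v)
      ≈⟨ x∙yz≈z∙xy _ _ _ ⟩
    v * (𝟙 (F ∧ s) * weight v w x y U) ∎
    where
    F s : Bool
    F = fishburn (Vec.map merge U)
    s = penultimate (columnOr U)
    unitRow : Vec Bool (suc (suc m))
    unitRow = replicate (suc m) false ∷ʳ true
    H : Vec Bool (suc (suc m)) → Carrier
    H r = 𝟙 (fishburn (U ∷ʳ r)) * weight v w x y (U ∷ʳ r)
    vanish : ∀ {r} → fishburn (U ∷ʳ r) ≡ false → H r ≈ 0#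
    vanish eq = trans (*-congʳ (reflexive (cong 𝟙 eq))) (zeroˡ _)

  ∑-fishburn-∷ʳ : (m : ℕ) (v w x y : Carrier) →
    ∑ (allMatrices (suc (suc m))) (λ N → 𝟙 (fishburn N) * weight v w x y N)
      ≈ v * ∑ (vecsOver (bitVectors (suc (suc m))) (suc m))
              (λ U → 𝟙 (fishburn (Vec.map merge U) ∧ penultimate (columnOr U)) * weight v w x y U)
  ∑-fishburn-∷ʳ m v w x y = trans (∑-vecsOver-∷ʳ (bitVectors (suc (suc m))) (suc m) _)
    (trans (∑-cong Us (∑-lastRow v w x y)) (∑-*ˡ Us v _))
    where
    Us : List (Vec (Vec Bool (suc (suc m))) (suc m))
    Us = vecsOver (bitVectors (suc (suc m))) (suc m)

  ∑-merged : (m : ℕ) (v w x y : Carrier) →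
    ∑ (vecsOver (bitVectors (suc (suc m))) (suc m)) (λ U → 𝟙 (fishburn (Vec.map merge U)) * weight v w x y U)
      ≈ P R (suc m) (v + w + v * w) w (x + y + x * y) y
  ∑-merged m v w x y = trans
    (∑-vecsOver-map {k = suc m} (bitVectors (suc (suc m))) (bitVectors (suc m)) merge
      (fishburnRow v w x y) (fishburnRow (v + w + v * w) w (x + y + x * y) y) mergeRow (𝟙 ∘ fishburn))
    (sym (P-as-sum m (v + w + v * w) w (x + y + x * y) y))
    where
    mergeRow : ∀ t (H : Vec Bool (suc m) → Carrier) →
      ∑ (bitVectors (suc (suc m))) (λ r → H (merge r) * fishburnRow v w x y t r)
        ≈ ∑ (bitVectors (suc m)) (λ r → H r * fishburnRow (v + w + v * w) w (x + y + x * y) y t r)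
    mergeRow zero    H = ∑-merge-cell y x H
    mergeRow (suc t) H = ∑-merge-cell w v H

  ∑-merged-penultimateZero : (m : ℕ) (v w x y : Carrier) →
    ∑ (vecsOver (bitVectors (suc (suc m))) (suc m))
      (λ U → 𝟙 (fishburn (Vec.map merge U) ∧ not (penultimate (columnOr U))) * weight v w x y U)
      ≈ P R (suc m) v w x y
  ∑-merged-penultimateZero m v w x y = begin
    ∑ Us (λ U → 𝟙 (fishburn (Vec.map merge U) ∧ not (penultimate (columnOr U))) * weight v w x y U)
      ≈⟨ ∑-cong Us split ⟩
    ∑ Us (λ U → 𝟙 (fishburn (Vec.map merge U)) * ∏ (mapWithIndex ρ U))
      ≈⟨ ∑-vecsOver-map {k = suc m} (bitVectors (suc (suc m))) (bitVectors (suc m)) merge ρ (fishburnRow v w x y)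
           mergeRow (𝟙 ∘ fishburn) ⟩
    ∑ (allMatrices (suc m)) (λ M → 𝟙 (fishburn M) * weight v w x y M)
      ≈⟨ P-as-sum m v w x y ⟨
    P R (suc m) v w x y ∎
    where
    Us : List (Vec (Vec Bool (suc (suc m))) (suc m))
    Us = vecsOver (bitVectors (suc (suc m))) (suc m)
    ρ : ℕ → Vec Bool (suc (suc m)) → Carrier
    ρ t r = 𝟙 (not (penultimate r)) * fishburnRow v w x y t r
    split : ∀ U → 𝟙 (fishburn (Vec.map merge U) ∧ not (penultimate (columnOr U))) * weight v w x y U
                    ≈ 𝟙 (fishburn (Vec.map merge U)) * ∏ (mapWithIndex ρ U)
    split U = trans (*-congʳ (𝟙-∧ (fishburn (Vec.map merge U)) _)) (trans (*-assoc _ _ _) (*-congˡ (trans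
      (*-congʳ (reflexive (cong 𝟙 (not-penultimate-columnOr U))))
      (𝟙-and-mapWithIndex-* _ (fishburnRow v w x y) U))))
    mergeRow : ∀ t (H : Vec Bool (suc m) → Carrier) →
      ∑ (bitVectors (suc (suc m))) (λ r → H (merge r) * ρ t r)
        ≈ ∑ (bitVectors (suc m)) (λ r → H r * fishburnRow v w x y t r)
    mergeRow zero    H = ∑-merge-penultimateZero y (cell x) H
    mergeRow (suc t) H = ∑-merge-penultimateZero w (cell v) H

lemma8 : ∀ {c ℓ} (R : CommutativeRing c ℓ) → let open CommutativeRing R in
           (k : ℕ) → 1 ≤ k → (v w x y : Carrier) →
           P R (suc k) v w x y ≈ v * P R k (v + w + v * w) w (x + y + x * y) y - v * P R k v w x y
lemma8 R (suc m) (s≤s z≤n) v w x y = begin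
  P R (suc (suc m)) v w x y
    ≈⟨ P-as-sum (suc m) v w x y ⟩
  ∑ (allMatrices (suc (suc m))) (λ N → 𝟙 (fishburn N) * weight v w x y N)
    ≈⟨ ∑-fishburn-∷ʳ m v w x y ⟩
  v * ∑ Us (λ U → 𝟙 (F U ∧ s U) * weight v w x y U)
    ≈⟨ *-congˡ (∑-𝟙-∧ Us F s (weight v w x y)) ⟩
  v * (∑ Us (λ U → 𝟙 (F U) * weight v w x y U) - ∑ Us (λ U → 𝟙 (F U ∧ not (s U)) * weight v w x y U))
    ≈⟨ *-congˡ (+-cong (∑-merged m v w x y) (-‿cong (∑-merged-penultimateZero m v w x y))) ⟩
  v * (P R (suc m) (v + w + v * w) w (x + y + x * y) y - P R (suc m) v w x y)
    ≈⟨ x[y-z]≈xy-xz v _ _ ⟩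
  v * P R (suc m) (v + w + v * w) w (x + y + x * y) y - v * P R (suc m) v w x y ∎
  where
  open CommutativeRing R
  open RingProperties ring using (x[y-z]≈xy-xz)
  open import Relation.Binary.Reasoning.Setoid setoid
  open RingSums R
  open FishburnWeights R
  Us : List (Vec (Vec Bool (suc (suc m))) (suc m))
  Us = vecsOver (bitVectors (suc (suc m))) (suc m)
  F s : Vec (Vec Bool (suc (suc m))) (suc m) → Bool
  F U = fishburn (Vec.map merge U)
  s U = penultimate (columnOr U)
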